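{- Let $n \ge 2$, $[n] = \{1, \ldots, n\}$, and fix $m \in [n]$. For $A \subseteq [n]$ define $\psi_m A = A$ if $m \notin A$, and $\psi_m A = \big((\{0,1,\ldots,n\} \setminus A) \cup \{m\}\big) \setminus \{0\}$ if $m \in A$. Let $S_1 \subseteq S_2 \subseteq \cdots \subseteq S_k$ and $T_1 \subseteq T_2 \subseteq \cdots \subseteq T_\ell$ be two chains of subsets of $[n]$ which are disjoint in the sense that $S_k \cap T_\ell = \emptyset$. Then: (1) If $m \notin S_k$ and $m \notin T_\ell$, then $\psi_m S_u = S_u$ for all $u$ and $\psi_m T_v = T_v$ for all $v$, so the images are again two disjoint chains. (2) If $m \in S_k$ and $m \notin T_\ell$, let $i$ be the smallest index with $m \in S_i$. Then the images form the two disjoint chains \[ \psi_m S_1 = S_1 \subseteq \cdots \subseteq \psi_m S_{i-1} = S_{i-1} \] and \[ \psi_m T_1 = T_1 \subseteq \cdots \subseteq \psi_m T_\ell = T_\ell \subseteq \psi_m S_k \subseteq \psi_m S_{k-1} \subseteq \cdots \subseteq \psi_m S_{i+1} \subseteq \psi_m S_i , \] where "disjoint" means that the largest set of the first chain, $S_{i-1}$ (when $i \ge 2$), is disjoint from the largest set $\psi_m S_i$ of the second chain.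
   Context: The map $\psi_m$ on subsets of $[n]$ describes the effect of the transposition $(0, m)$ of $\{0,1,\ldots,n\}$ on subsets of $[n]$ (using that a boundary divisor indexed by a subset agrees with the one indexed by its complement in $\{0,1,\ldots,n\}$). Two chains of subsets of $[n]$ are called disjoint if their largest members are disjoint. -}

module Defs where

open import Data.Nat using (ℕ; suc)
open import Data.Fin using (Fin; zero; suc; _≤_)
open import Data.Fin.Subset using (Subset; outside; ∁; _∪_; ⁅_⁆; _∈_; _∉_; _⊆_)
open import Data.Vec using (_∷_; tail)
open import Relation.Nullary using (Dec; yes; no)
open import Data.Fin.Subset.Properties using (_∈?_)

-- Conventions: a subset of [n] = {1,…,n} is a  Subset n ; index j : Fin n
-- stands for the element (toℕ j + 1).  A subset of {0,1,…,n} is a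
-- Subset (suc n); index zero stands for 0 and  suc j  for toℕ j + 1.

embed : ∀ {n} → Subset n → Subset (suc n)
embed A = outside ∷ A

drop0 : ∀ {n} → Subset (suc n) → Subset n
drop0 B = tail B

ψ : ∀ {n} → Fin n → Subset n → Subset n
ψ m A with m ∈? A
... | yes _ = drop0 (∁ (embed A) ∪ ⁅ suc m ⁆)
... | no _  = A

IsChain : ∀ {n k} → (Fin k → Subset n) → Set
IsChain {k = k} S = (u v : Fin k) → u ≤ v → S u ⊆ S v

-- On sets avoiding m, ψ_m is the identity; on sets containing m it is
-- A ↦ ([n] ∖ A) ∪ {m}, which reverses inclusion. So the part of the S-chain
-- from the first index containing m on is turned upside down, and since T is
-- disjoint from S_k it lies in the complement of S_k, hence below ψ_m S_k.

module Submission where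

open import Defs
open import Data.Nat using (ℕ; suc; _≤_)
import Data.Nat.Properties as ℕ
open import Data.Fin using (Fin; toℕ; fromℕ; _<_) renaming (_≤_ to _≤ᶠ_)
open import Data.Fin.Properties using (≤fromℕ)
open import Data.Fin.Subset using (Subset; _∈_; _∉_; _⊆_; _∩_; _∪_; ∁; ⁅_⁆; Empty)
open import Data.Fin.Subset.Properties
  using (_∈?_; x∈⁅y⁆⇒x≡y; x∈∁p⇒x∉p; x∉p⇒x∈∁p; x∈p∩q⁺; x∈p∩q⁻; x∈p∪q⁻; x∈p∪q⁺; p⊆p∪q; ⊆-trans)
open import Data.Product using (_×_; _,_)
open import Data.Sum using (inj₁; inj₂)
open import Relation.Nullary using (yes; no; contradiction)
open import Relation.Binary.PropositionalEquality using (_≡_; refl; sym; subst; subst₂)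

module _ {n : ℕ} {A B : Subset n} where

  ∁-∪-antitone : (C : Subset n) → A ⊆ B → ∁ B ∪ C ⊆ ∁ A ∪ C
  ∁-∪-antitone C A⊆B x∈∁B∪C with x∈p∪q⁻ (∁ B) C x∈∁B∪C
  ... | inj₁ x∈∁B = x∈p∪q⁺ (inj₁ (x∉p⇒x∈∁p (λ x∈A → x∈∁p⇒x∉p x∈∁B (A⊆B x∈A))))
  ... | inj₂ x∈C  = x∈p∪q⁺ (inj₂ x∈C)

  disjoint⇒⊆∁ : Empty (A ∩ B) → B ⊆ ∁ A
  disjoint⇒⊆∁ A∩B≡∅ {x} x∈B = x∉p⇒x∈∁p (λ x∈A → A∩B≡∅ (x , x∈p∩q⁺ (x∈A , x∈B)))

  ⊆-disjoint-∁-∪-⁅⁆ : ∀ {m} → m ∉ A → A ⊆ B → Empty (A ∩ (∁ B ∪ ⁅ m ⁆))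
  ⊆-disjoint-∁-∪-⁅⁆ {m} m∉A A⊆B (x , x∈A∩[∁B∪m]) with x∈p∩q⁻ A _ x∈A∩[∁B∪m]
  ... | x∈A , x∈∁B∪m with x∈p∪q⁻ (∁ B) ⁅ m ⁆ x∈∁B∪m
  ...   | inj₁ x∈∁B = x∈∁p⇒x∉p x∈∁B (A⊆B x∈A)
  ...   | inj₂ x∈m  = m∉A (subst (_∈ A) (x∈⁅y⁆⇒x≡y m x∈m) x∈A)

module _ {n : ℕ} (m : Fin n) where

  ψ-∉ : ∀ {A} → m ∉ A → ψ m A ≡ A
  ψ-∉ {A} m∉A with m ∈? A
  ... | yes m∈A = contradiction m∈A m∉A
  ... | no _    = refl

  -- Dropping 0 from the complement of  embed A  in {0,…,n} is the complement
  -- of A in [n], so this holds by computation.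
  ψ-∈ : ∀ {A} → m ∈ A → ψ m A ≡ ∁ A ∪ ⁅ m ⁆
  ψ-∈ {A} m∈A with m ∈? A
  ... | yes _   = refl
  ... | no m∉A  = contradiction m∈A m∉A

  ψ-monotone-∉ : ∀ {A B} → m ∉ B → A ⊆ B → ψ m A ⊆ ψ m B
  ψ-monotone-∉ m∉B A⊆B rewrite ψ-∉ m∉B | ψ-∉ (λ m∈A → m∉B (A⊆B m∈A)) = A⊆B

  ψ-antitone-∈ : ∀ {A B} → m ∈ A → A ⊆ B → ψ m B ⊆ ψ m A
  ψ-antitone-∈ m∈A A⊆B rewrite ψ-∈ (A⊆B m∈A) | ψ-∈ m∈A = ∁-∪-antitone ⁅ m ⁆ A⊆B

  ψ-disjoint-∉-∈ : ∀ {A B} → m ∉ A → m ∈ B → A ⊆ B → Empty (ψ m A ∩ ψ m B)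
  ψ-disjoint-∉-∈ m∉A m∈B A⊆B rewrite ψ-∉ m∉A | ψ-∈ m∈B = ⊆-disjoint-∁-∪-⁅⁆ m∉A A⊆B

  ψ-disjoint⇒⊆ : ∀ {A B} → m ∉ A → m ∈ B → Empty (B ∩ A) → ψ m A ⊆ ψ m B
  ψ-disjoint⇒⊆ m∉A m∈B B∩A≡∅ rewrite ψ-∉ m∉A | ψ-∈ m∈B =
    ⊆-trans (disjoint⇒⊆∁ B∩A≡∅) (p⊆p∪q ⁅ m ⁆)

  module _ {k : ℕ} {S : Fin (suc k) → Subset n} (chain : IsChain S) where

    ∉-top⇒∉ : m ∉ S (fromℕ k) → ∀ u → m ∉ S u
    ∉-top⇒∉ m∉top u m∈Su = m∉top (chain u (fromℕ k) (≤fromℕ u) m∈Su)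

    ∉-top⇒ψ-fixes : m ∉ S (fromℕ k) → ∀ u → ψ m (S u) ≡ S u
    ∉-top⇒ψ-fixes m∉top u = ψ-∉ (∉-top⇒∉ m∉top u)

    ∉-top⇒ψ-chain : m ∉ S (fromℕ k) → IsChain (λ u → ψ m (S u))
    ∉-top⇒ψ-chain m∉top u v u≤v = ψ-monotone-∉ (∉-top⇒∉ m∉top v) (chain u v u≤v)

proposition2p1 : (n : ℕ) → 2 ≤ n → (m : Fin n) → (k' ℓ' : ℕ)
    → (S : Fin (suc k') → Subset n) → (T : Fin (suc ℓ') → Subset n)
    → IsChain S → IsChain T
    → Empty (S (fromℕ k') ∩ T (fromℕ ℓ'))
    → ((m ∉ S (fromℕ k') → m ∉ T (fromℕ ℓ')
         → ((u : Fin (suc k')) → ψ m (S u) ≡ S u)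
           × ((v : Fin (suc ℓ')) → ψ m (T v) ≡ T v)
           × IsChain (λ u → ψ m (S u)) × IsChain (λ v → ψ m (T v))
           × Empty (ψ m (S (fromℕ k')) ∩ ψ m (T (fromℕ ℓ'))))
       × ((i : Fin (suc k')) → m ∈ S i → ((j : Fin (suc k')) → j < i → m ∉ S j)
         → m ∉ T (fromℕ ℓ')
         → ((u : Fin (suc k')) → u < i → ψ m (S u) ≡ S u)
           × ((u v : Fin (suc k')) → u ≤ᶠ v → v < i → ψ m (S u) ⊆ ψ m (S v))
           × ((v : Fin (suc ℓ')) → ψ m (T v) ≡ T v)
           × IsChain (λ v → ψ m (T v))
           × ψ m (T (fromℕ ℓ')) ⊆ ψ m (S (fromℕ k'))
           × ((u v : Fin (suc k')) → i ≤ᶠ u → u ≤ᶠ v → ψ m (S v) ⊆ ψ m (S u))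
           × ((j : Fin (suc k')) → suc (toℕ j) ≡ toℕ i
              → Empty (ψ m (S j) ∩ ψ m (S i)))))
proposition2p1 n _ m k' ℓ' S T chainS chainT disjoint =
    (λ m∉Sₖ m∉Tₗ →
        ∉-top⇒ψ-fixes m chainS m∉Sₖ
      , ∉-top⇒ψ-fixes m chainT m∉Tₗ
      , ∉-top⇒ψ-chain m chainS m∉Sₖ
      , ∉-top⇒ψ-chain m chainT m∉Tₗ
      , subst₂ (λ A B → Empty (A ∩ B)) (sym (ψ-∉ m m∉Sₖ)) (sym (ψ-∉ m m∉Tₗ)) disjoint)
  , (λ i m∈Sᵢ m∉S<i m∉Tₗ →
        (λ u u<i → ψ-∉ m (m∉S<i u u<i))
      , (λ u v u≤v v<i → ψ-monotone-∉ m (m∉S<i v v<i) (chainS u v u≤v))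
      , ∉-top⇒ψ-fixes m chainT m∉Tₗ
      , ∉-top⇒ψ-chain m chainT m∉Tₗ
      , ψ-disjoint⇒⊆ m m∉Tₗ (chainS i (fromℕ k') (≤fromℕ i) m∈Sᵢ) disjoint
      , (λ u v i≤u u≤v → ψ-antitone-∈ m (chainS i u i≤u m∈Sᵢ) (chainS u v u≤v))
      , λ j j+1≡i → let j<i = ℕ.≤-reflexive j+1≡i in
          ψ-disjoint-∉-∈ m (m∉S<i j j<i) m∈Sᵢ (chainS j i (ℕ.<⇒≤ j<i)))
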